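{- Let $T=(V,E)$ be a tree of order at least three, $u,v\in V$, and $t\ge 2$ an integer. Then: (i) if $\epsilon(u)\ge\epsilon(v)$ (eccentricities in $T$), then $\epsilon(u^t)\ge\epsilon(v^t)$ (eccentricities in $S(T,t)$); (ii) $\epsilon(u^t)=\epsilon(z^{t-1})+(2^t-1)\epsilon(u)-(2^{t-1}-1)$, where $\epsilon(u^t)$ is the eccentricity of $u^t$ in $S(T,t)$, $\epsilon(z^{t-1})$ is the eccentricity of $z^{t-1}$ in $S(T,t-1)$, $\epsilon(u)$ is the eccentricity of $u$ in $T$, and $z$ is the support vertex of an eccentric vertex for $u$ in $T$.
   Context: For a graph $G=(V,E)$ and a positive integer $t$, $V^t$ denotes the set of words of length $t$ over the alphabet $V$, and $x^k$ denotes the word consisting of $k$ copies of the letter $x$. The generalized Sierpiński graph $S(G,t)$ has vertex set $V^t$ and edge set $\{\{w u_i u_j^{d-1}, w u_j u_i^{d-1}\} : \{u_i,u_j\}\in E,\ d\in\{1,\dots,t\},\ w\in V^{t-d}\}$; $S(G,1)=G$. The eccentricity $\epsilon(v)$ of a vertex $v$ in a connected graph is the maximum distance from $v$ to any other vertex; an eccentric vertex for $v$ is a vertex at distance $\epsilon(v)$ from $v$. A leaf is a vertex of degree one and a support vertex is a vertex adjacent to a leaf (in a tree of order at least three an eccentric vertex for $u$ is a leaf, whose unique neighbour is its support vertex). -}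

module Defs where

open import Data.Nat using (ℕ; zero; suc; _≤_)
open import Data.Fin using (Fin)
open import Data.Vec using (Vec; _∷_; replicate)
open import Data.List using (List; _∷_; []; _++_; length)
open import Data.List.Relation.Unary.Linked using (Linked)
open import Data.List.Relation.Unary.Unique.Propositional using (Unique)
open import Data.Product using (Σ; ∃; _×_)
open import Data.Empty using (⊥)
open import Relation.Nullary using (¬_)
open import Relation.Binary.PropositionalEquality using (_≡_)

record Graph (V : Set) : Set₁ where
  field
    Adj : V → V → Set

open Graph public

module _ {V : Set} (G : Graph V) where

  data Walk : V → V → ℕ → Set where
    [] : ∀ {x} → Walk x x 0
    _∷_ : ∀ {x y z d} → Adj G x y → Walk y z d → Walk x z (suc d)

  Dist : V → V → ℕ → Set
  Dist x y d = Walk x y d × (∀ d′ → Walk x y d′ → d ≤ d′)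

  -- e is the eccentricity of x (graphs used here are connected)
  Ecc : V → ℕ → Set
  Ecc x e = (∀ y d → Dist x y d → d ≤ e) × ∃ (λ y → Dist x y e)

  EccentricVertex : V → V → Set
  EccentricVertex x y = ∃ (λ e → Ecc x e × Dist x y e)

  Connected : Set
  Connected = ∀ x y → ∃ (λ d → Walk x y d)

  IsCycle : V → List V → Set
  IsCycle x xs = Unique (x ∷ xs) × Linked (Adj G) (x ∷ xs ++ x ∷ []) × 2 ≤ length xs

  Acyclic : Set
  Acyclic = ∀ x xs → ¬ IsCycle x xs

record Tree (n : ℕ) : Set₁ where
  field
    graph     : Graph (Fin n)
    sym       : ∀ x y → Adj graph x y → Adj graph y x
    irrefl    : ∀ x → ¬ Adj graph x x
    connected : Connected graph
    acyclic   : Acyclic graph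

-- Generalized Sierpiński graph S(G,t) on words V^t.
-- Edges {w a b^{d-1}, w b a^{d-1}} for {a,b} ∈ E, w ∈ V^{t-d}.

data SAdj {V : Set} (G : Graph V) : (t : ℕ) → Vec V t → Vec V t → Set where
  here  : ∀ {k a b} → Adj G a b →
          SAdj G (suc k) (a ∷ replicate k b) (b ∷ replicate k a)
  there : ∀ {k w x y} → SAdj G k x y → SAdj G (suc k) (w ∷ x) (w ∷ y)

Sierpinski : {V : Set} → Graph V → (t : ℕ) → Graph (Vec V t)
Sierpinski G t = record { Adj = SAdj G t }

module Submission where

-- In S(T,t) the eccentricity of u^t equals (2^t − 1)·ε(u) + (diam T − 2)·Σ_{i<t} (2^i − 1), and both parts
-- follow from this formula, (ii) because the support z of an eccentric vertex of u has ε(z) = diam T − 1.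
-- Upper bound: a word a·s is reached from u^(t+1) by following the u–a path in constant words (each tree edge
-- costs 2^t − 1 moves), crossing into the block of a from its parent q and recursing from q^t; the budget
-- closes because the parent of a vertex at distance ε(u) has eccentricity diam T − 1. Lower bound: a vertex y
-- farthest from u is a leaf, so its block is entered only through the edge z·y^t — y·z^t, and before that a
-- 1-Lipschitz potential bounds the length walked. The facts about trees come from d(p,q) = h p + h q − 2·h(p ∧ q)
-- for the heights h in the tree rooted at a vertex.

open import Defs
open import Data.Nat using (ℕ; zero; suc; pred; >-nonZero; _≟_; _≤_; _<_; _+_; _*_; _∸_; _^_; _⊓_; _⊔_; z≤n; s≤s; _≤?_)
open import Data.Nat.Properties
open import Data.Nat.Induction using (<-rec)
open import Data.Fin as Fin using (Fin)
open import Data.Vec using (Vec; []; _∷_; replicate)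
open import Data.List using (List; []; _∷_; _++_; length)
open import Data.List.Membership.Propositional using (_∈_; _∉_)
open import Data.List.Relation.Binary.Subset.Propositional using (_⊆_)
open import Data.List.Relation.Unary.All.Properties.Core using (¬Any⇒All¬)
open import Data.List.Relation.Unary.All using ([])
open import Data.List.Relation.Unary.AllPairs using ([]; _∷_)
open import Data.List.Relation.Unary.Any using (here; there)
open import Data.List.Relation.Unary.Linked using (Linked; [-]; _∷_)
open import Data.List.Relation.Unary.Unique.Propositional using (Unique)
open import Data.Product using (Σ; ∃; _×_; _,_; proj₁; proj₂)
open import Data.Sum using (_⊎_; inj₁; inj₂)
open import Data.Empty using (⊥; ⊥-elim)
open import Relation.Nullary using (¬_; Dec; yes; no)
open import Relation.Nullary.Decidable using (decidable-stable)
open import Relation.Binary.Definitions using (DecidableEquality; tri<; tri≈; tri>)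
open import Relation.Binary.PropositionalEquality
  using (_≡_; _≢_; refl; sym; trans; cong; cong₂; subst; subst₂; module ≡-Reasoning)
open import Data.Nat.Tactic.RingSolver using (solve-∀)

module Walks {V : Set} (G : Graph V) where

  infixr 5 _++ʷ_
  infixl 5 _∷ʳ_

  _++ʷ_ : ∀ {a b c d e} → Walk G a b d → Walk G b c e → Walk G a c (d + e)
  [] ++ʷ W′ = W′
  (e ∷ W) ++ʷ W′ = e ∷ (W ++ʷ W′)

  _∷ʳ_ : ∀ {a b c d} → Walk G a b d → Adj G b c → Walk G a c (suc d)
  [] ∷ʳ e = e ∷ []
  (e′ ∷ W) ∷ʳ e = e′ ∷ (W ∷ʳ e)

  unsnoc : ∀ {a c d} → Walk G a c (suc d) → ∃ λ b → Walk G a b d × Adj G b c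
  unsnoc (e ∷ []) = _ , [] , e
  unsnoc (e ∷ W@(_ ∷ _)) with unsnoc W
  ... | b , W′ , e′ = b , e ∷ W′ , e′

  walk⇒¬¬dist : ∀ {x y d} → Walk G x y d → ¬ ¬ ∃ (Dist G x y)
  walk⇒¬¬dist {x} {y} W ¬dist = <-rec (λ d → ¬ Walk G x y d) no-walk _ W
    where
    no-walk : ∀ d → (∀ {d′} → d′ < d → ¬ Walk G x y d′) → ¬ Walk G x y d
    no-walk d shorter W = ¬dist (d , W , minimal)
      where
      minimal : ∀ d′ → Walk G x y d′ → d ≤ d′
      minimal d′ W′ = decidable-stable (d ≤? d′) (λ d≰d′ → shorter (≰⇒> d≰d′) W′)

module Paths {V : Set} (_≟_ : DecidableEquality V) (G : Graph V)
             (adj-sym : ∀ x y → Adj G x y → Adj G y x) where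

  open Walks G
  open import Data.List.Membership.DecPropositional _≟_ using (_∈?_)

  vertices : ∀ {a b d} → Walk G a b d → List V
  vertices {a} [] = a ∷ []
  vertices {a} (_ ∷ W) = a ∷ vertices W

  IsPath : ∀ {a b d} → Walk G a b d → Set
  IsPath W = Unique (vertices W)

  suffixFrom : ∀ {a x b d} (W : Walk G x b d) → a ∈ vertices W →
               ∃ λ d′ → Σ (Walk G a b d′) λ S → (IsPath W → IsPath S) × vertices S ⊆ vertices W
  suffixFrom [] (here refl) = _ , [] , (λ p → p) , (λ m → m)
  suffixFrom (e ∷ W) (here refl) = _ , e ∷ W , (λ p → p) , (λ m → m)
  suffixFrom (e ∷ W) (there a∈W) with suffixFrom W a∈W
  ... | _ , S , path , S⊆W = _ , S , (λ { (_ ∷ p) → path p }) , (λ m → there (S⊆W m))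

  toPath : ∀ {a b d} (W : Walk G a b d) →
           ∃ λ d′ → Σ (Walk G a b d′) λ P → IsPath P × vertices P ⊆ vertices W
  toPath [] = _ , [] , [] ∷ [] , (λ m → m)
  toPath {a} (e ∷ W) with toPath W
  ... | _ , P , path , P⊆W with a ∈? vertices P
  ... | yes a∈P with suffixFrom P a∈P
  ...   | _ , S , S-path , S⊆P = _ , S , S-path path , (λ m → there (P⊆W (S⊆P m)))
  toPath {a} (e ∷ W) | _ , P , path , P⊆W | no a∉P =
    _ , e ∷ P , ¬Any⇒All¬ _ a∉P ∷ path , λ { (here r) → here r ; (there m) → there (P⊆W m) }

  ∈-++ʷ : ∀ {a b c d e w} (W : Walk G a b d) (W′ : Walk G b c e) →
          w ∈ vertices (W ++ʷ W′) → w ∈ vertices W ⊎ w ∈ vertices W′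
  ∈-++ʷ [] W′ m = inj₂ m
  ∈-++ʷ (e ∷ W) W′ (here r) = inj₁ (here r)
  ∈-++ʷ (e ∷ W) W′ (there m) with ∈-++ʷ W W′ m
  ... | inj₁ p = inj₁ (there p)
  ... | inj₂ p = inj₂ p

  ∈-∷ʳ : ∀ {a b c d w} (W : Walk G a b d) (e : Adj G b c) →
         w ∈ vertices (W ∷ʳ e) → w ∈ vertices W ⊎ w ≡ c
  ∈-∷ʳ [] e (here r) = inj₁ (here r)
  ∈-∷ʳ [] e (there (here r)) = inj₂ r
  ∈-∷ʳ (e′ ∷ W) e (here r) = inj₁ (here r)
  ∈-∷ʳ (e′ ∷ W) e (there m) with ∈-∷ʳ W e m
  ... | inj₁ p = inj₁ (there p)
  ... | inj₂ p = inj₂ p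

  reverse : ∀ {a b d} → Walk G a b d → Walk G b a d
  reverse [] = []
  reverse (e ∷ W) = reverse W ∷ʳ adj-sym _ _ e

  vertices-reverse : ∀ {a b d} (W : Walk G a b d) → vertices (reverse W) ⊆ vertices W
  vertices-reverse [] m = m
  vertices-reverse (e ∷ W) m with ∈-∷ʳ (reverse W) (adj-sym _ _ e) m
  ... | inj₁ p = there (vertices-reverse W p)
  ... | inj₂ refl = here refl

  module _ (acyclic : Acyclic G) where

    -- v, a, …, b, v would be a cycle
    no-bypass : ∀ {v a b d} (P : Walk G a b d) → IsPath P → Adj G v a → Adj G b v →
                v ∉ vertices P → a ≢ b → ⊥
    no-bypass [] _ _ _ _ a≢b = a≢b refl
    no-bypass {v} {b = b} P@(_ ∷ W) path va bv v∉P _ =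
      acyclic v (vertices P) (¬Any⇒All¬ _ v∉P ∷ path , va ∷ closing P , s≤s (1≤length W))
      where
      closing : ∀ {a d} (W : Walk G a b d) → Linked (Adj G) (vertices W ++ v ∷ [])
      closing [] = bv ∷ [-]
      closing (e ∷ []) = e ∷ bv ∷ [-]
      closing (e ∷ W@(_ ∷ _)) = e ∷ closing W
      1≤length : ∀ {a b d} (W : Walk G a b d) → 1 ≤ length (vertices W)
      1≤length [] = s≤s z≤n
      1≤length (_ ∷ _) = s≤s z≤n

maxᶠ : ∀ {m} → (Fin m → ℕ) → ℕ
maxᶠ {zero} f = 0
maxᶠ {suc m} f = f Fin.zero ⊔ maxᶠ (λ i → f (Fin.suc i))

≤-maxᶠ : ∀ {m} (f : Fin m → ℕ) i → f i ≤ maxᶠ f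
≤-maxᶠ f Fin.zero = m≤m⊔n _ _
≤-maxᶠ f (Fin.suc i) = ≤-trans (≤-maxᶠ (λ i → f (Fin.suc i)) i) (m≤n⊔m _ _)

maxᶠ-lub : ∀ {m} (f : Fin m → ℕ) {c} → (∀ i → f i ≤ c) → maxᶠ f ≤ c
maxᶠ-lub {zero} f bound = z≤n
maxᶠ-lub {suc m} f bound = ⊔-lub (bound Fin.zero) (maxᶠ-lub (λ i → f (Fin.suc i)) (λ i → bound (Fin.suc i)))

maxᶠ-attained : ∀ {m} (f : Fin m → ℕ) → 0 < m → ∃ λ i → f i ≡ maxᶠ f
maxᶠ-attained {suc m} f _ = attained f
  where
  attained : ∀ {m} (f : Fin (suc m) → ℕ) → ∃ λ i → f i ≡ maxᶠ f
  attained {zero} f = Fin.zero , sym (⊔-identityʳ (f Fin.zero))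
  attained {suc m} f with ⊔-sel (f Fin.zero) (maxᶠ (λ i → f (Fin.suc i)))
  ... | inj₁ eq = Fin.zero , sym eq
  ... | inj₂ eq with attained (λ i → f (Fin.suc i))
  ... | i , fi≡max = Fin.suc i , trans fi≡max (sym eq)

greatest-≤ : (P : ℕ → Set) → (∀ k → Dec (P k)) → P 0 → ∀ m →
             ∃ λ k → k ≤ m × P k × (∀ {j} → j ≤ m → P j → j ≤ k)
greatest-≤ P P? P0 zero = 0 , z≤n , P0 , λ { z≤n _ → z≤n }
greatest-≤ P P? P0 (suc m) with P? (suc m)
... | yes Pm = suc m , ≤-refl , Pm , (λ j≤ _ → j≤)
... | no ¬Pm with greatest-≤ P P? P0 m
... | k , k≤m , Pk , greatest = k , m≤n⇒m≤1+n k≤m , Pk , greatest′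
  where
  greatest′ : ∀ {j} → j ≤ suc m → P j → j ≤ k
  greatest′ {j} j≤ Pj with j ≤? m
  ... | yes j≤m = greatest j≤m Pj
  ... | no j≰m with ≤-antisym j≤ (≰⇒> j≰m)
  ... | refl = ⊥-elim (¬Pm Pj)

¬¬-∀Fin : ∀ {k} {P : Fin k → Set} → (∀ i → ¬ ¬ P i) → ¬ ¬ (∀ i → P i)
¬¬-∀Fin {zero} _ ¬all = ¬all (λ ())
¬¬-∀Fin {suc k} {P} ¬¬P ¬all =
  ¬¬P Fin.zero λ P0 → ¬¬-∀Fin {k} {λ i → P (Fin.suc i)} (λ i → ¬¬P (Fin.suc i))
    λ Psuc → ¬all λ { Fin.zero → P0 ; (Fin.suc i) → Psuc i }

another : ∀ {n} → 2 ≤ n → (x : Fin n) → ∃ λ y → x ≢ y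
another (s≤s (s≤s _)) Fin.zero = Fin.suc Fin.zero , λ ()
another (s≤s (s≤s _)) (Fin.suc _) = Fin.zero , λ ()

three-distinct : ∀ {n} → 3 ≤ n → Σ (Fin n) λ a → Σ (Fin n) λ b → Σ (Fin n) λ c → a ≢ b × b ≢ c × a ≢ c
three-distinct (s≤s (s≤s (s≤s _))) =
  Fin.zero , Fin.suc Fin.zero , Fin.suc (Fin.suc Fin.zero) , (λ ()) , (λ ()) , (λ ())

module TreeMetric {n : ℕ} (T : Tree n) (shortest : ∀ x y → ∃ (Dist (Tree.graph T) x y)) where

  open Tree T using (irrefl; acyclic) renaming (graph to G; sym to adj-sym)
  open Walks G
  open Paths Fin._≟_ G adj-sym

  dist : Fin n → Fin n → ℕ
  dist x y = proj₁ (shortest x y)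

  dist-walk : ∀ x y → Walk G x y (dist x y)
  dist-walk x y = proj₁ (proj₂ (shortest x y))

  dist-minimal : ∀ {x y d} → Walk G x y d → dist x y ≤ d
  dist-minimal {x} {y} = proj₂ (proj₂ (shortest x y)) _

  Dist⇒≡dist : ∀ {x y d} → Dist G x y d → d ≡ dist x y
  Dist⇒≡dist (W , minimal) = ≤-antisym (minimal _ (dist-walk _ _)) (dist-minimal W)

  dist-step : ∀ x {a b} → Adj G a b → dist x b ≤ suc (dist x a)
  dist-step x {a} e = dist-minimal (dist-walk x a ∷ʳ e)

  dist-refl : ∀ x → dist x x ≡ 0
  dist-refl x = n≤0⇒n≡0 (dist-minimal [])

  dist-sym : ∀ x y → dist x y ≡ dist y x
  dist-sym x y = ≤-antisym (dist-minimal (reverse (dist-walk y x))) (dist-minimal (reverse (dist-walk x y)))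

  dist≡0⇒≡ : ∀ {x y} → dist x y ≡ 0 → x ≡ y
  dist≡0⇒≡ {x} {y} d≡0 = walk₀ (subst (Walk G x y) d≡0 (dist-walk x y))
    where
    walk₀ : ∀ {x y} → Walk G x y 0 → x ≡ y
    walk₀ [] = refl

  ≢⇒0<dist : ∀ {x y} → x ≢ y → 0 < dist x y
  ≢⇒0<dist x≢y = n≢0⇒n>0 (λ d≡0 → x≢y (dist≡0⇒≡ d≡0))

  adj⊎2≤dist : ∀ {a b} → a ≢ b → Adj G a b ⊎ 2 ≤ dist a b
  adj⊎2≤dist {a} {b} a≢b with dist a b ≤? 1
  ... | no d≰1 = inj₂ (≰⇒> d≰1)
  ... | yes d≤1 = inj₁ (walk₁ (subst (Walk G a b) (≤-antisym d≤1 (≢⇒0<dist a≢b)) (dist-walk a b)))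
    where
    walk₁ : Walk G a b 1 → Adj G a b
    walk₁ (e ∷ []) = e

  module Rooted (r : Fin n) where

    height : Fin n → ℕ
    height = dist r

    penultimate : ∀ {v d} → Walk G r v d → Fin n
    penultimate [] = r
    penultimate W@(_ ∷ _) = proj₁ (unsnoc W)

    parent : Fin n → Fin n
    parent v = penultimate (dist-walk r v)

    parent-spec : ∀ {v k} → height v ≡ suc k →
                  Adj G (parent v) v × Walk G r (parent v) k × height (parent v) ≡ k
    parent-spec {v} {k} hv≡ with last-step (dist-walk r v) hv≡
      where
      last-step : ∀ {d} (W : Walk G r v d) → d ≡ suc k → Adj G (penultimate W) v × Walk G r (penultimate W) k
      last-step W@(_ ∷ _) refl with unsnoc W
      ... | _ , W′ , e = e , W′
    ... | e , W = e , W , ≤-antisym (dist-minimal W) (≤-pred (≤-trans (≤-reflexive (sym hv≡)) (dist-step r e)))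

    parent-adj : ∀ {v} → 0 < height v → Adj G (parent v) v
    parent-adj {v} 0<h = proj₁ (parent-spec (sym (suc-pred (height v) {{>-nonZero 0<h}})))

    height-parent : ∀ {v} → 0 < height v → suc (height (parent v)) ≡ height v
    height-parent {v} 0<h = trans (cong suc (proj₂ (proj₂ (parent-spec (sym h≡))))) h≡
      where
      h≡ : suc (pred (height v)) ≡ height v
      h≡ = suc-pred (height v) {{>-nonZero 0<h}}

    height-on-walk : ∀ {a b d w} (W : Walk G a b d) → w ∈ vertices W → height w ≤ height a + d
    height-on-walk {a} {d = d} [] (here refl) = m≤m+n (height a) d
    height-on-walk {a} {d = d} (e ∷ W) (here refl) = m≤m+n (height a) d
    height-on-walk {a} {d = suc d} (e ∷ W) (there w∈W) =
      ≤-trans (height-on-walk W w∈W) (≤-trans (+-monoˡ-≤ d (dist-step r e)) (≤-reflexive (sym (+-suc (height a) d))))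

    low-path : ∀ {p q k} → Walk G r p k → Walk G r q k →
               ∃ λ d → Σ (Walk G p q d) λ P → IsPath P × (∀ {w} → w ∈ vertices P → height w ≤ k)
    low-path Wp Wq with toPath (reverse Wp ++ʷ Wq)
    ... | d , P , path , P⊆W = d , P , path , λ w∈P → bound (∈-++ʷ (reverse Wp) Wq (P⊆W w∈P))
      where
      from-root : ∀ {b k w} (W : Walk G r b k) → w ∈ vertices W → height w ≤ k
      from-root {k = k} {w} W w∈W = subst (λ h → height w ≤ h + k) (dist-refl r) (height-on-walk W w∈W)
      bound : ∀ {w} → w ∈ vertices (reverse Wp) ⊎ w ∈ vertices Wq → height w ≤ _
      bound (inj₁ w∈) = from-root Wp (vertices-reverse Wp w∈)
      bound (inj₂ w∈) = from-root Wq w∈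

    -- w → parent w ⇝ parent v → v → w, with the middle part staying below v and w, would be a cycle
    adj⇒height≢ : ∀ {v w} → Adj G v w → height v ≢ height w
    adj⇒height≢ {v} {w} e hv≡hw with height v in hv≡
    ... | zero = irrefl v (subst (Adj G v) (sym (trans (sym (dist≡0⇒≡ hv≡)) (dist≡0⇒≡ (sym hv≡hw)))) e)
    ... | suc k with parent-spec hv≡ | parent-spec (sym hv≡hw)
    ... | ev , Wv , hpv | ew , Ww , hpw with low-path Ww Wv
    ... | _ , P , path , low = no-bypass acyclic (adj-sym _ _ ew ∷ P) (¬Any⇒All¬ _ w∉P ∷ path) e ev v∉P w≢pv
      where
      w∉P : w ∉ vertices P
      w∉P w∈P = 1+n≰n (subst (_≤ k) (sym hv≡hw) (low w∈P))
      v∉P : v ∉ vertices (adj-sym _ _ ew ∷ P)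
      v∉P (here v≡w) = irrefl v (subst (Adj G v) (sym v≡w) e)
      v∉P (there v∈P) = 1+n≰n (subst (_≤ k) hv≡ (low v∈P))
      w≢pv : w ≢ parent v
      w≢pv w≡pv = 1+n≰n (subst (_≤ k) (sym hv≡hw) (subst (λ u → height u ≤ k) (sym w≡pv) (≤-reflexive hpv)))

    -- otherwise p ⇝ parent v, staying below v, → v → p would be a cycle
    adj-up⇒parent : ∀ {p v} → Adj G p v → suc (height p) ≡ height v → p ≡ parent v
    adj-up⇒parent {p} {v} e hv≡ with parent-spec (sym hv≡)
    ... | ev , Wpv , _ with p Fin.≟ parent v
    ... | yes p≡pv = p≡pv
    ... | no p≢pv with low-path (dist-walk r p) Wpv
    ... | _ , P , path , low = ⊥-elim (no-bypass acyclic P path (adj-sym _ _ e) ev v∉P p≢pv)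
      where
      v∉P : v ∉ vertices P
      v∉P v∈P = 1+n≰n (subst (_≤ height p) (sym hv≡) (low v∈P))

    adj⇒parent : ∀ {v w} → Adj G v w →
                 (w ≡ parent v × suc (height w) ≡ height v) ⊎ (v ≡ parent w × suc (height v) ≡ height w)
    adj⇒parent {v} {w} e with <-cmp (height v) (height w)
    ... | tri≈ _ hv≡hw _ = ⊥-elim (adj⇒height≢ e hv≡hw)
    ... | tri< hv<hw _ _ = inj₂ (adj-up⇒parent e up , up)
      where up = ≤-antisym hv<hw (dist-step r e)
    ... | tri> _ _ hw<hv = inj₁ (adj-up⇒parent (adj-sym _ _ e) up , up)
      where up = ≤-antisym hw<hv (dist-step r (adj-sym _ _ e))

    ancestor : ℕ → Fin n → Fin n
    ancestor zero v = v
    ancestor (suc j) v = parent (ancestor j v)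

    ancestor-+ : ∀ i j v → ancestor (i + j) v ≡ ancestor i (ancestor j v)
    ancestor-+ zero j v = refl
    ancestor-+ (suc i) j v = cong parent (ancestor-+ i j v)

    ancestor-parent : ∀ j v → ancestor j (parent v) ≡ ancestor (suc j) v
    ancestor-parent j v = trans (sym (ancestor-+ j 1 v)) (cong (λ i → ancestor i v) (+-comm j 1))

    0<height-ancestor : ∀ {j v} → j < height v → 0 < height (ancestor j v)

    height-ancestor : ∀ {j v} → j ≤ height v → height (ancestor j v) ≡ height v ∸ j
    height-ancestor {zero} _ = refl
    height-ancestor {suc j} {v} j<h = begin
      height (parent (ancestor j v))  ≡⟨ cong pred (height-parent (0<height-ancestor j<h)) ⟩
      pred (height (ancestor j v))    ≡⟨ cong pred (height-ancestor (<⇒≤ j<h)) ⟩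
      pred (height v ∸ j)             ≡⟨ pred[m∸n]≡m∸[1+n] (height v) j ⟩
      height v ∸ suc j                ∎
      where open ≡-Reasoning

    0<height-ancestor j<h = subst (0 <_) (sym (height-ancestor (<⇒≤ j<h))) (m<n⇒0<n∸m j<h)

    ancestor-root : ∀ v → ancestor (height v) v ≡ r
    ancestor-root v = sym (dist≡0⇒≡ (trans (height-ancestor ≤-refl) (n∸n≡0 (height v))))

    walk-to-ancestor : ∀ {j v} → j ≤ height v → Walk G v (ancestor j v) j
    walk-to-ancestor {zero} _ = []
    walk-to-ancestor {suc j} j<h = walk-to-ancestor (<⇒≤ j<h) ∷ʳ adj-sym _ _ (parent-adj (0<height-ancestor j<h))

    ancestorAt : ℕ → Fin n → Fin n
    ancestorAt k v = ancestor (height v ∸ k) v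

    ancestorAt-≤ : ∀ {k′ k v} → k′ ≤ k → k ≤ height v → ancestorAt k′ v ≡ ancestor (k ∸ k′) (ancestorAt k v)
    ancestorAt-≤ {k′} {k} {v} k′≤k k≤h = trans (cong (λ j → ancestor j v) split) (ancestor-+ (k ∸ k′) (height v ∸ k) v)
      where
      open ≡-Reasoning
      split : height v ∸ k′ ≡ (k ∸ k′) + (height v ∸ k)
      split = begin
        height v ∸ k′                  ≡⟨ cong (_∸ k′) (sym (m∸n+n≡m k≤h)) ⟩
        (height v ∸ k) + k ∸ k′        ≡⟨ +-∸-assoc (height v ∸ k) k′≤k ⟩
        (height v ∸ k) + (k ∸ k′)      ≡⟨ +-comm (height v ∸ k) (k ∸ k′) ⟩
        (k ∸ k′) + (height v ∸ k)      ∎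

    ancestorAt-parent : ∀ {k v} → k ≤ height (parent v) → suc (height (parent v)) ≡ height v →
                        ancestorAt k (parent v) ≡ ancestorAt k v
    ancestorAt-parent {k} {v} k≤h hv≡ =
      trans (ancestor-parent (height (parent v) ∸ k) v) (cong (λ j → ancestor j v) (sym one-more))
      where
      one-more : height v ∸ k ≡ suc (height (parent v) ∸ k)
      one-more = trans (cong (_∸ k) (sym hv≡)) (+-∸-assoc 1 k≤h)

    CommonAt : Fin n → Fin n → ℕ → Set
    CommonAt p q k = ancestorAt k p ≡ ancestorAt k q

    CommonAt-≤ : ∀ {p q k k′} → CommonAt p q k → k′ ≤ k → k ≤ height p → k ≤ height q → CommonAt p q k′
    CommonAt-≤ {k = k} {k′} common k′≤k k≤p k≤q =
      trans (ancestorAt-≤ k′≤k k≤p) (trans (cong (ancestor (k ∸ k′)) common) (sym (ancestorAt-≤ k′≤k k≤q)))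

    meet-search : ∀ p q → ∃ λ k → k ≤ height p ⊓ height q × CommonAt p q k ×
                                  (∀ {j} → j ≤ height p ⊓ height q → CommonAt p q j → j ≤ k)
    meet-search p q = greatest-≤ (CommonAt p q) (λ k → ancestorAt k p Fin.≟ ancestorAt k q)
                                 (trans (ancestor-root p) (sym (ancestor-root q))) (height p ⊓ height q)

    meet : Fin n → Fin n → ℕ
    meet p q = proj₁ (meet-search p q)

    meet≤ˡ : ∀ p q → meet p q ≤ height p
    meet≤ˡ p q = ≤-trans (proj₁ (proj₂ (meet-search p q))) (m⊓n≤m (height p) (height q))

    meet≤ʳ : ∀ p q → meet p q ≤ height q
    meet≤ʳ p q = ≤-trans (proj₁ (proj₂ (meet-search p q))) (m⊓n≤n (height p) (height q))

    common-meet : ∀ p q → CommonAt p q (meet p q)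
    common-meet p q = proj₁ (proj₂ (proj₂ (meet-search p q)))

    meet-greatest : ∀ {p q k} → k ≤ height p → k ≤ height q → CommonAt p q k → k ≤ meet p q
    meet-greatest {p} {q} k≤p k≤q = proj₂ (proj₂ (proj₂ (meet-search p q))) (⊓-glb k≤p k≤q)

    dist+2meet≤ : ∀ p q → dist p q + 2 * meet p q ≤ height p + height q
    dist+2meet≤ p q = ≤-trans (+-monoˡ-≤ (2 * m) (dist-minimal (up-from-p ++ʷ down-to-q))) (≤-reflexive lengths)
      where
      m = meet p q
      up-from-p : Walk G p (ancestorAt m p) (height p ∸ m)
      up-from-p = walk-to-ancestor (m∸n≤m (height p) m)
      down-to-q : Walk G (ancestorAt m p) q (height q ∸ m)
      down-to-q = subst (λ a → Walk G a q (height q ∸ m)) (sym (common-meet p q)) (reverse (walk-to-ancestor (m∸n≤m (height q) m)))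
      lengths : (height p ∸ m) + (height q ∸ m) + 2 * m ≡ height p + height q
      lengths = trans (regroup (height p ∸ m) (height q ∸ m) m)
                      (cong₂ _+_ (m∸n+n≡m (meet≤ˡ p q)) (m∸n+n≡m (meet≤ʳ p q)))
        where
        regroup : ∀ x y m → x + y + 2 * m ≡ (x + m) + (y + m)
        regroup = solve-∀

    -- Moving to a child cannot lower the meet with p; moving to the parent lowers it by at most one.
    meet-step : ∀ p {v w} ℓ → Adj G v w → height v + height p ≤ ℓ + 2 * meet p v →
                height w + height p ≤ suc ℓ + 2 * meet p w
    meet-step p {w = w} ℓ e ≤ℓ with adj⇒parent e
    ... | inj₂ (refl , hw≡) = subst (λ h → h + height p ≤ suc ℓ + 2 * meet p w) hw≡
                                (s≤s (≤-trans ≤ℓ (+-monoʳ-≤ ℓ (*-monoʳ-≤ 2 meet-grows))))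
      where
      meet-grows : meet p (parent w) ≤ meet p w
      meet-grows = meet-greatest (meet≤ˡ p _) (≤-trans (meet≤ʳ p _) (≤-trans (n≤1+n _) (≤-reflexive hw≡)))
                     (trans (common-meet p _) (ancestorAt-parent (meet≤ʳ p _) hw≡))
    meet-step p {v} ℓ e ≤ℓ | inj₁ (refl , hv≡) with meet p v ≤? height (parent v)
    ... | yes m≤h = ≤-trans (n≤1+n _) (≤-trans (subst (λ h → h + height p ≤ ℓ + 2 * meet p v) (sym hv≡) ≤ℓ)
                      (+-mono-≤ (n≤1+n ℓ) (*-monoʳ-≤ 2 meet-grows)))
      where
      meet-grows : meet p v ≤ meet p (parent v)
      meet-grows = meet-greatest (meet≤ˡ p v) m≤h (trans (common-meet p v) (sym (ancestorAt-parent m≤h hv≡)))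
    ... | no m≰h = arith (height (parent v)) (height p) ℓ (meet p (parent v))
                     (subst₂ (λ h m → h + height p ≤ ℓ + 2 * m) (sym hv≡) m≡ ≤ℓ) meet-at-parent
      where
      m≡ : meet p v ≡ suc (height (parent v))
      m≡ = ≤-antisym (≤-trans (meet≤ʳ p v) (≤-reflexive (sym hv≡))) (≰⇒> m≰h)
      h≤m : height (parent v) ≤ meet p v
      h≤m = ≤-trans (n≤1+n _) (≤-reflexive (sym m≡))
      meet-at-parent : height (parent v) ≤ meet p (parent v)
      meet-at-parent = meet-greatest (≤-trans h≤m (meet≤ˡ p v)) ≤-refl
        (trans (CommonAt-≤ (common-meet p v) h≤m (meet≤ˡ p v) (meet≤ʳ p v)) (sym (ancestorAt-parent ≤-refl hv≡)))
      arith : ∀ a b ℓ x → suc a + b ≤ ℓ + 2 * suc a → a ≤ x → a + b ≤ suc ℓ + 2 * x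
      arith a b ℓ x le a≤x =
        ≤-trans (≤-pred (subst (suc a + b ≤_) (shift ℓ a) le)) (+-monoʳ-≤ (suc ℓ) (*-monoʳ-≤ 2 a≤x))
        where
        shift : ∀ ℓ a → ℓ + 2 * suc a ≡ suc (suc ℓ + 2 * a)
        shift = solve-∀

    meet-walk : ∀ p ℓ {v w d} → Walk G v w d → height v + height p ≤ ℓ + 2 * meet p v →
                height w + height p ≤ (ℓ + d) + 2 * meet p w
    meet-walk p ℓ {v} [] ≤ℓ = subst (λ k → height v + height p ≤ k + 2 * meet p v) (sym (+-identityʳ ℓ)) ≤ℓ
    meet-walk p ℓ {w = w} (_∷_ {d = d} e W) ≤ℓ =
      subst (λ k → height w + height p ≤ k + 2 * meet p w) (sym (+-suc ℓ d)) (meet-walk p (suc ℓ) W (meet-step p ℓ e ≤ℓ))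

    dist+2meet≡ : ∀ p q → dist p q + 2 * meet p q ≡ height p + height q
    dist+2meet≡ p q = ≤-antisym (dist+2meet≤ p q)
      (≤-trans (≤-reflexive (+-comm (height p) (height q))) (meet-walk p 0 (dist-walk p q) at-p))
      where
      at-p : height p + height p ≤ 0 + 2 * meet p p
      at-p = ≤-trans (≤-reflexive (double (height p))) (*-monoʳ-≤ 2 (meet-greatest ≤-refl ≤-refl refl))
        where
        double : ∀ h → h + h ≡ 0 + 2 * h
        double = solve-∀

    dist≤dist-from-deepest : ∀ {y b c} → (∀ v → height v ≤ height y) → meet y b ≤ meet y c → dist b c ≤ dist y b
    dist≤dist-from-deepest {y} {b} {c} deepest mb≤mc = +-cancelʳ-≤ (2 * meet y b) _ _ (begin
      dist b c + 2 * meet y b   ≤⟨ +-monoʳ-≤ (dist b c) (*-monoʳ-≤ 2 meet-yb≤meet-bc) ⟩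
      dist b c + 2 * meet b c   ≡⟨ dist+2meet≡ b c ⟩
      height b + height c       ≤⟨ +-monoʳ-≤ (height b) (deepest c) ⟩
      height b + height y       ≡⟨ +-comm (height b) (height y) ⟩
      height y + height b       ≡⟨ sym (dist+2meet≡ y b) ⟩
      dist y b + 2 * meet y b   ∎)
      where
      open ≤-Reasoning
      meet-yb≤meet-bc : meet y b ≤ meet b c
      meet-yb≤meet-bc = meet-greatest (meet≤ʳ y b) (≤-trans mb≤mc (meet≤ʳ y c))
        (trans (sym (common-meet y b)) (CommonAt-≤ (common-meet y c) mb≤mc (meet≤ˡ y c) (meet≤ʳ y c)))

    deepest-dominates : ∀ {y} → (∀ v → height v ≤ height y) → ∀ b c → dist b c ≤ dist y b ⊎ dist b c ≤ dist y c
    deepest-dominates {y} deepest b c with ≤-total (meet y b) (meet y c)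
    ... | inj₁ mb≤mc = inj₁ (dist≤dist-from-deepest deepest mb≤mc)
    ... | inj₂ mc≤mb = inj₂ (subst (_≤ dist y c) (dist-sym c b) (dist≤dist-from-deepest deepest mc≤mb))

  open Rooted using (parent; parent-adj; adj⇒parent; deepest-dominates)

  ecc : Fin n → ℕ
  ecc x = maxᶠ (dist x)

  diam : ℕ
  diam = maxᶠ ecc

  dist≤ecc : ∀ x y → dist x y ≤ ecc x
  dist≤ecc x = ≤-maxᶠ (dist x)

  ecc≤diam : ∀ x → ecc x ≤ diam
  ecc≤diam = ≤-maxᶠ ecc

  Ecc⇒≡ecc : ∀ {x e} → Ecc G x e → e ≡ ecc x
  Ecc⇒≡ecc {x} (bounded , y , x-y) =
    ≤-antisym (≤-trans (≤-reflexive (Dist⇒≡dist x-y)) (dist≤ecc x y))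
              (maxᶠ-lub (dist x) (λ b → bounded b (dist x b) (proj₂ (shortest x b))))

  ecc-adj : ∀ {y z} → Adj G y z → ecc y ≤ suc (ecc z)
  ecc-adj {y} {z} e = maxᶠ-lub (dist y) (λ b → ≤-trans (dist-minimal (e ∷ dist-walk z b)) (s≤s (dist≤ecc z b)))

  0<ecc : 2 ≤ n → ∀ x → 0 < ecc x
  0<ecc 2≤n x with another 2≤n x
  ... | y , x≢y = ≤-trans (≢⇒0<dist x≢y) (dist≤ecc x y)

  2≤diam : 3 ≤ n → 2 ≤ diam
  2≤diam 3≤n with three-distinct 3≤n
  ... | a , b , c , a≢b , b≢c , a≢c with adj⊎2≤dist a≢b | adj⊎2≤dist b≢c | adj⊎2≤dist a≢c
  ... | inj₂ 2≤ | _ | _ = ≤-trans 2≤ (≤-trans (dist≤ecc _ _) (ecc≤diam _))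
  ... | inj₁ _ | inj₂ 2≤ | _ = ≤-trans 2≤ (≤-trans (dist≤ecc _ _) (ecc≤diam _))
  ... | inj₁ _ | inj₁ _ | inj₂ 2≤ = ≤-trans 2≤ (≤-trans (dist≤ecc _ _) (ecc≤diam _))
  ... | inj₁ ab | inj₁ bc | inj₁ ac =
    ⊥-elim (no-bypass acyclic (bc ∷ []) ((¬Any⇒All¬ _ (λ { (here b≡c) → b≢c b≡c }) ∷ [] ∷ [])) ab (adj-sym _ _ ac)
              (λ { (here a≡b) → a≢b a≡b ; (there (here a≡c)) → a≢c a≡c }) b≢c)

  Farthest : Fin n → Fin n → Set
  Farthest x a = ∀ v → dist x v ≤ dist x a

  eccentric⇒farthest : ∀ {x a} → dist x a ≡ ecc x → Farthest x a
  eccentric⇒farthest {x} a-ecc v = ≤-trans (dist≤ecc x v) (≤-reflexive (sym a-ecc))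

  farthest-leaf : ∀ {x a w} → Farthest x a → Adj G a w → w ≡ parent x a
  farthest-leaf {x} {a} {w} far e with adj⇒parent x e
  ... | inj₁ (w≡p , _) = w≡p
  ... | inj₂ (_ , up) = ⊥-elim (1+n≰n (≤-trans (≤-reflexive up) (far w)))

  ecc-support≤ : ∀ {x a δ} → diam ≡ 2 + δ → Farthest x a → 0 < dist x a → ecc (parent x a) ≤ suc δ
  ecc-support≤ {x} {a} {δ} diam≡ far 0<d = maxᶠ-lub (dist (parent x a)) bound
    where
    through-parent : ∀ {b d} → Walk G a b d → a ≢ b → suc (dist (parent x a) b) ≤ d
    through-parent [] a≢b = ⊥-elim (a≢b refl)
    through-parent (e ∷ W) _ with farthest-leaf far e
    ... | refl = s≤s (dist-minimal W)
    bound : ∀ b → dist (parent x a) b ≤ suc δ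
    bound b with a Fin.≟ b
    ... | yes refl = ≤-trans (dist-minimal (parent-adj x 0<d ∷ [])) (s≤s z≤n)
    ... | no a≢b = ≤-pred (≤-trans (through-parent (dist-walk a b) a≢b)
                     (≤-trans (dist≤ecc a b) (≤-trans (ecc≤diam a) (≤-reflexive diam≡))))

  farthest⇒peripheral : ∀ {x y} → 0 < n → Farthest x y → diam ≤ ecc y
  farthest⇒peripheral {x} {y} 0<n far with maxᶠ-attained ecc 0<n
  ... | b , ecc-b≡diam with maxᶠ-attained (dist b) 0<n
  ... | c , dist-bc≡ecc-b with deepest-dominates x far b c
  ... | inj₁ ≤yb = ≤-trans (≤-reflexive (trans (sym ecc-b≡diam) (sym dist-bc≡ecc-b))) (≤-trans ≤yb (dist≤ecc y b))
  ... | inj₂ ≤yc = ≤-trans (≤-reflexive (trans (sym ecc-b≡diam) (sym dist-bc≡ecc-b))) (≤-trans ≤yc (dist≤ecc y c))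

  ecc-support : ∀ {x y δ} → 0 < n → diam ≡ 2 + δ → Farthest x y → 0 < dist x y → ecc (parent x y) ≡ suc δ
  ecc-support {x} {y} 0<n diam≡ far 0<d =
    ≤-antisym (ecc-support≤ diam≡ far 0<d)
              (≤-pred (≤-trans (≤-reflexive (sym diam≡))
                (≤-trans (farthest⇒peripheral 0<n far) (ecc-adj (adj-sym _ _ (parent-adj x 0<d))))))

mersenne : ℕ → ℕ
mersenne zero = 0
mersenne (suc t) = mersenne t + suc (mersenne t)

2^≡1+mersenne : ∀ t → 2 ^ t ≡ suc (mersenne t)
2^≡1+mersenne zero = refl
2^≡1+mersenne (suc t) = trans (cong (2 *_) (2^≡1+mersenne t)) (double (mersenne t))
  where
  double : ∀ m → 2 * suc m ≡ suc (m + suc m)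
  double = solve-∀

module SierpinskiWalks {V : Set} (G : Graph V) where

  lift : ∀ {k a s s′ d} → Walk (Sierpinski G k) s s′ d → Walk (Sierpinski G (suc k)) (a ∷ s) (a ∷ s′) d
  lift [] = []
  lift (e ∷ W) = there e ∷ lift W

  -- a^(t+1) → a b^t → b a^t → b^(t+1)
  edge-walk : ∀ {t a b} → Adj G a b → Walk (Sierpinski G t) (replicate t a) (replicate t b) (mersenne t)
  edge-walk {zero} e = []
  edge-walk {suc t} e = lift (edge-walk e) ++ʷ (here e ∷ lift (edge-walk e))
    where open Walks (Sierpinski G (suc t))

  replicate-walk : ∀ {t a b k} → Walk G a b k → Walk (Sierpinski G t) (replicate t a) (replicate t b) (k * mersenne t)
  replicate-walk [] = []
  replicate-walk {t} (e ∷ W) = edge-walk e ++ʷ replicate-walk W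
    where open Walks (Sierpinski G t)

module SierpinskiEcc {n : ℕ} (T : Tree n) (shortest : ∀ x y → ∃ (Dist (Tree.graph T) x y)) (3≤n : 3 ≤ n) where

  open Tree T using (irrefl) renaming (graph to G; sym to adj-sym)
  open TreeMetric T shortest
  open Rooted using (parent; parent-spec)
  open SierpinskiWalks G

  S : (t : ℕ) → Graph (Vec (Fin n) t)
  S t = Sierpinski G t

  0<n : 0 < n
  0<n = ≤-trans (s≤s z≤n) 3≤n

  2≤n : 2 ≤ n
  2≤n = ≤-trans (n≤1+n 2) 3≤n

  δ : ℕ
  δ = diam ∸ 2

  diam≡ : diam ≡ 2 + δ
  diam≡ = sym (m+[n∸m]≡n (2≤diam 3≤n))

  offset : ℕ → ℕ
  offset zero = 0
  offset (suc t) = offset t + mersenne t * δ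

  eccˢ : ℕ → Fin n → ℕ
  eccˢ t x = mersenne t * ecc x + offset t

  -- vanishes at x^k and changes by at most one along an edge, hence bounds the distance from x^k
  module Potential (x : Fin n) where

    potential : ∀ {k} → Vec (Fin n) k → ℕ
    potential [] = 0
    potential {suc k} (a ∷ s) = suc (mersenne k) * dist x a + potential s

    potential-replicate : ∀ k b → potential (replicate k b) ≡ mersenne k * dist x b
    potential-replicate zero b = refl
    potential-replicate (suc k) b =
      trans (cong (suc (mersenne k) * dist x b +_) (potential-replicate k b)) (collect (mersenne k) (dist x b))
      where
      collect : ∀ m h → suc m * h + m * h ≡ (m + suc m) * h
      collect = solve-∀

    potential-step : ∀ {k v v′} → SAdj G k v v′ → potential v′ ≤ suc (potential v)
    potential-step {suc k} (there {w = a} e) =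
      ≤-trans (+-monoʳ-≤ (suc (mersenne k) * dist x a) (potential-step e)) (≤-reflexive (+-suc _ _))
    potential-step {suc k} (here {a = a} {b = b} e) =
      subst₂ (λ pa pb → suc (mersenne k) * dist x b + pa ≤ suc (suc (mersenne k) * dist x a + pb))
             (sym (potential-replicate k a)) (sym (potential-replicate k b))
             (swap (mersenne k) (dist x a) (dist x b) (dist-step x e))
      where
      swap : ∀ m ha hb → hb ≤ suc ha → suc m * hb + m * ha ≤ suc (suc m * ha + m * hb)
      swap m ha hb hb≤ = ≤-trans (≤-reflexive (split m ha hb))
        (≤-trans (+-monoˡ-≤ (m * hb + m * ha) hb≤) (≤-reflexive (merge m ha hb)))
        where
        split : ∀ m ha hb → suc m * hb + m * ha ≡ hb + (m * hb + m * ha)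
        split = solve-∀
        merge : ∀ m ha hb → suc ha + (m * hb + m * ha) ≡ suc (suc m * ha + m * hb)
        merge = solve-∀

  -- for a ≠ x: x^(t+1) → q^(t+1) → q·a^t → a·q^t → a·s, where q is the parent of a in the tree rooted at x
  short-walk : ∀ t x (w : Vec (Fin n) t) → ∃ λ ℓ → Walk (S t) (replicate t x) w ℓ × ℓ ≤ eccˢ t x
  short-walk zero x [] = 0 , [] , z≤n
  short-walk (suc t) x (a ∷ s) with dist x a in d≡
  ... | zero with dist≡0⇒≡ d≡
  ...   | refl with short-walk t x s
  ...     | ℓ , W , ℓ≤ =
    ℓ , lift W , ≤-trans ℓ≤ (+-mono-≤ (*-monoˡ-≤ (ecc x) (m≤m+n M (suc M))) (m≤m+n (offset t) (M * δ)))
    where M = mersenne t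
  short-walk (suc t) x (a ∷ s) | suc k with parent-spec x d≡
  ... | e , W-xq , _ with short-walk t (parent x a) s
  ... | ℓ , W , ℓ≤ = _ , replicate-walk W-xq ++ʷ (lift (edge-walk e) ++ʷ (here e ∷ lift W)) , bound
    where
    open Walks (S (suc t))
    open ≤-Reasoning
    M = mersenne t
    M′ = mersenne (suc t)
    q = parent x a
    0<d : 0 < dist x a
    0<d = subst (0 <_) (sym d≡) (s≤s z≤n)
    via-q : ∀ {b} → ecc q ≤ b → k * M′ + (M + suc ℓ) ≤ k * M′ + (M + suc (M * b + offset t))
    via-q ecc≤b = +-monoʳ-≤ (k * M′) (+-monoʳ-≤ M (s≤s (≤-trans ℓ≤ (+-monoˡ-≤ (offset t) (*-monoʳ-≤ M ecc≤b)))))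
    bound : k * M′ + (M + suc ℓ) ≤ eccˢ (suc t) x
    bound with suc k ≟ ecc x
    ... | yes a-ecc = begin
      k * M′ + (M + suc ℓ)                     ≤⟨ via-q (ecc-support≤ diam≡ (eccentric⇒farthest (trans d≡ a-ecc)) 0<d) ⟩
      k * M′ + (M + suc (M * suc δ + offset t)) ≡⟨ last-edge M k δ (offset t) ⟩
      M′ * suc k + (offset t + M * δ)          ≡⟨ cong (λ e → M′ * e + (offset t + M * δ)) a-ecc ⟩
      eccˢ (suc t) x                           ∎
      where
      last-edge : ∀ M k δ c → k * (M + suc M) + (M + suc (M * suc δ + c)) ≡ (M + suc M) * suc k + (c + M * δ)
      last-edge = solve-∀
    ... | no a-not-ecc = begin
      k * M′ + (M + suc ℓ)                           ≤⟨ via-q (≤-trans (ecc≤diam q) (≤-reflexive diam≡)) ⟩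
      k * M′ + (M + suc (M * (2 + δ) + offset t))     ≤⟨ m≤m+n _ (suc M) ⟩
      k * M′ + (M + suc (M * (2 + δ) + offset t)) + suc M ≡⟨ two-short M k δ (offset t) ⟩
      M′ * suc (suc k) + (offset t + M * δ)          ≤⟨ +-monoˡ-≤ _ (*-monoʳ-≤ M′ k+2≤e) ⟩
      eccˢ (suc t) x                                 ∎
      where
      k+2≤e : suc (suc k) ≤ ecc x
      k+2≤e = ≤∧≢⇒< (subst (_≤ ecc x) d≡ (dist≤ecc x a)) a-not-ecc
      two-short : ∀ M k δ c → k * (M + suc M) + (M + suc (M * (2 + δ) + c)) + suc M ≡ (M + suc M) * suc (suc k) + (c + M * δ)
      two-short = solve-∀

  -- y is a leaf with support z, so a walk enters the block y·V^t only through the edge z·y^t — y·z^t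
  module LeafBlock (t : ℕ) {x y : Fin n} (far : Farthest x y) (0<d : 0 < dist x y) where

    open Potential x
    open Walks (S t) using (_∷ʳ_)

    z : Fin n
    z = parent x y

    entry : ℕ
    entry = suc (potential (z ∷ replicate t y))

    Invariant : Vec (Fin n) (suc t) → ℕ → Set
    Invariant (a ∷ s) L = (a ≢ y → potential (a ∷ s) ≤ L) ×
                          (a ≡ y → ∃ λ m → Walk (S t) (replicate t z) s m × entry + m ≤ L)

    invariant-step : ∀ {v v′ L} → SAdj G (suc t) v v′ → Invariant v L → Invariant v′ (suc L)
    invariant-step (there e) (outside , inside) =
      (λ a≢y → ≤-trans (potential-step (there e)) (s≤s (outside a≢y))) ,
      (λ a≡y → let (m , W , ≤L) = inside a≡y in suc m , W ∷ʳ e , ≤-trans (≤-reflexive (+-suc entry m)) (s≤s ≤L))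
    invariant-step {L = L} (here {a = a} {b = b} e) (outside , inside) = leaving , entering
      where
      leaving : b ≢ y → potential (b ∷ replicate t a) ≤ suc L
      leaving b≢y with a Fin.≟ y
      ... | no a≢y = ≤-trans (potential-step (here {k = t} e)) (s≤s (outside a≢y))
      ... | yes refl with farthest-leaf far e
      ... | refl with inside refl
      ... | m , _ , ≤L = ≤-trans (n≤1+n _) (≤-trans (m≤m+n entry m) (≤-trans ≤L (n≤1+n L)))
      entering : b ≡ y → ∃ λ m → Walk (S t) (replicate t z) (replicate t a) m × entry + m ≤ suc L
      entering refl with farthest-leaf far (adj-sym _ _ e)
      ... | refl = 0 , [] , ≤-trans (≤-reflexive (+-identityʳ entry))
                                     (s≤s (outside (λ a≡y → irrefl a (subst (Adj G a) (sym a≡y) e))))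

    invariant-walk : ∀ {v w ℓ L} → Walk (S (suc t)) v w ℓ → Invariant v L → Invariant w (L + ℓ)
    invariant-walk {v} {L = L} [] inv = subst (Invariant v) (sym (+-identityʳ L)) inv
    invariant-walk {w = w} {L = L} (_∷_ {d = ℓ} e W) inv =
      subst (Invariant w) (sym (+-suc L ℓ)) (invariant-walk W (invariant-step e inv))

    invariant-start : Invariant (replicate (suc t) x) 0
    invariant-start = (λ _ → ≤-reflexive potential≡0) ,
                      (λ x≡y → ⊥-elim (<⇒≢ 0<d (trans (sym (dist-refl x)) (cong (dist x) x≡y))))
      where
      potential≡0 : potential (replicate (suc t) x) ≡ 0
      potential≡0 = trans (potential-replicate (suc t) x) (trans (cong (mersenne (suc t) *_) (dist-refl x)) (*-zeroʳ (mersenne (suc t))))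

  far-word : ∀ t x → ∃ λ w → ∀ {ℓ} → Walk (S t) (replicate t x) w ℓ → eccˢ t x ≤ ℓ
  far-word zero x = [] , λ _ → z≤n
  far-word (suc t) x with maxᶠ-attained (dist x) 0<n
  ... | y , y-ecc = y ∷ proj₁ (far-word t z) , bound
    where
    far : Farthest x y
    far = eccentric⇒farthest y-ecc
    0<d : 0 < dist x y
    0<d = subst (0 <_) (sym y-ecc) (0<ecc 2≤n x)
    open LeafBlock t far 0<d
    open Potential x using (potential; potential-replicate)
    M = mersenne t
    k = dist x z
    y≡ : suc k ≡ dist x y
    y≡ = Rooted.height-parent x 0<d
    entry+ecc≡ : entry + eccˢ t z ≡ eccˢ (suc t) x
    entry+ecc≡ = begin
      suc (suc M * k + potential (replicate t y)) + (M * ecc z + offset t)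
        ≡⟨ cong₂ (λ p e → suc (suc M * k + p) + (M * e + offset t))
                 (trans (potential-replicate t y) (cong (M *_) (sym y≡))) (ecc-support 0<n diam≡ far 0<d) ⟩
      suc (suc M * k + M * suc k) + (M * suc δ + offset t)
        ≡⟨ collect M k δ (offset t) ⟩
      (M + suc M) * suc k + (offset t + M * δ)
        ≡⟨ cong (λ e → (M + suc M) * e + (offset t + M * δ)) (trans y≡ y-ecc) ⟩
      eccˢ (suc t) x ∎
      where
      open ≡-Reasoning
      collect : ∀ M k δ c → suc (suc M * k + M * suc k) + (M * suc δ + c) ≡ (M + suc M) * suc k + (c + M * δ)
      collect = solve-∀
    bound : ∀ {ℓ} → Walk (S (suc t)) (replicate (suc t) x) (y ∷ proj₁ (far-word t z)) ℓ → eccˢ (suc t) x ≤ ℓ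
    bound W with proj₂ (invariant-walk W invariant-start) refl
    ... | m , W′ , ≤ℓ =
      ≤-trans (≤-reflexive (sym entry+ecc≡)) (≤-trans (+-monoʳ-≤ entry (proj₂ (far-word t z) W′)) ≤ℓ)

  Ecc⇒¬¬≡eccˢ : ∀ t x {e} → Ecc (S t) (replicate t x) e → ¬ ¬ (e ≡ eccˢ t x)
  Ecc⇒¬¬≡eccˢ t x (bounded , w₀ , x-w₀) ¬≡ with short-walk t x w₀ | far-word t x
  ... | ℓ₀ , W₀ , ℓ₀≤ | w* , far-bound with short-walk t x w*
  ... | _ , W* , _ = Walks.walk⇒¬¬dist (S t) W* λ { (d , x-w*) →
        ¬≡ (≤-antisym (≤-trans (proj₂ x-w₀ ℓ₀ W₀) ℓ₀≤) (≤-trans (far-bound (proj₁ x-w*)) (bounded w* d x-w*))) }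

  eccˢ-recurrence : ∀ t {u y z} → EccentricVertex G u y → Adj G z y →
                    eccˢ (suc t) u + mersenne t ≡ eccˢ t z + mersenne (suc t) * ecc u
  eccˢ-recurrence t {u} {y} {z} (_ , Ecc-u , u-y) zy = begin
    M′ * ecc u + (offset t + M * δ) + M   ≡⟨ regroup M (offset t) δ (ecc u) ⟩
    (M * suc δ + offset t) + M′ * ecc u   ≡⟨ cong (λ e → M * e + offset t + M′ * ecc u) (sym ecc-z) ⟩
    eccˢ t z + M′ * ecc u                 ∎
    where
    open ≡-Reasoning
    M = mersenne t
    M′ = mersenne (suc t)
    y-ecc : dist u y ≡ ecc u
    y-ecc = trans (sym (Dist⇒≡dist u-y)) (Ecc⇒≡ecc Ecc-u)
    0<d : 0 < dist u y
    0<d = subst (0 <_) (sym y-ecc) (0<ecc 2≤n u)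
    ecc-z : ecc z ≡ suc δ
    ecc-z = trans (cong ecc (farthest-leaf (eccentric⇒farthest y-ecc) (adj-sym _ _ zy)))
                  (ecc-support 0<n diam≡ (eccentric⇒farthest y-ecc) 0<d)
    regroup : ∀ M c δ e → (M + suc M) * e + (c + M * δ) + M ≡ (M * suc δ + c) + (M + suc M) * e
    regroup = solve-∀

  ecc-monotone : ∀ t {u v eu ev eut evt} → Ecc G u eu → Ecc G v ev →
                 Ecc (S t) (replicate t u) eut → Ecc (S t) (replicate t v) evt → ev ≤ eu → ¬ ¬ (evt ≤ eut)
  ecc-monotone t {u} {v} Ecc-u Ecc-v Ecc-ut Ecc-vt ev≤eu ¬≤ =
    Ecc⇒¬¬≡eccˢ t u Ecc-ut λ eut≡ → Ecc⇒¬¬≡eccˢ t v Ecc-vt λ evt≡ →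
      ¬≤ (subst₂ _≤_ (sym evt≡) (sym eut≡)
           (+-monoˡ-≤ (offset t) (*-monoʳ-≤ (mersenne t) (subst₂ _≤_ (Ecc⇒≡ecc Ecc-v) (Ecc⇒≡ecc Ecc-u) ev≤eu))))

  ecc-recurrence : ∀ t {u y z eu eut ezt} → EccentricVertex G u y → Adj G z y → Ecc G u eu →
                   Ecc (S (suc t)) (replicate (suc t) u) eut → Ecc (S t) (replicate t z) ezt →
                   ¬ ¬ (eut + (2 ^ t ∸ 1) ≡ ezt + (2 ^ suc t ∸ 1) * eu)
  ecc-recurrence t {u} {z = z} {eu} {eut} {ezt} uy zy Ecc-u Ecc-ut Ecc-zt ¬≡ =
    Ecc⇒¬¬≡eccˢ (suc t) u Ecc-ut λ eut≡ → Ecc⇒¬¬≡eccˢ t z Ecc-zt λ ezt≡ → ¬≡ (begin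
      eut + (2 ^ t ∸ 1)                      ≡⟨ cong₂ _+_ eut≡ (2^∸1≡mersenne t) ⟩
      eccˢ (suc t) u + mersenne t            ≡⟨ eccˢ-recurrence t uy zy ⟩
      eccˢ t z + mersenne (suc t) * ecc u    ≡⟨ cong₂ (λ e m → e + m * ecc u) (sym ezt≡) (sym (2^∸1≡mersenne (suc t))) ⟩
      ezt + (2 ^ suc t ∸ 1) * ecc u          ≡⟨ cong (λ e → ezt + (2 ^ suc t ∸ 1) * e) (sym (Ecc⇒≡ecc Ecc-u)) ⟩
      ezt + (2 ^ suc t ∸ 1) * eu             ∎)
    where
    open ≡-Reasoning
    2^∸1≡mersenne : ∀ t → 2 ^ t ∸ 1 ≡ mersenne t
    2^∸1≡mersenne t = cong (_∸ 1) (2^≡1+mersenne t)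

shortest-paths : ∀ {n} (T : Tree n) → ¬ ¬ (∀ x y → ∃ (Dist (Tree.graph T) x y))
shortest-paths T = ¬¬-∀Fin λ x → ¬¬-∀Fin λ y → Walks.walk⇒¬¬dist (Tree.graph T) (proj₂ (Tree.connected T x y))

-- Adjacency need not be decidable, so shortest walks exist only up to double negation; the
-- conclusions are decidable, so this suffices.
with-shortest-paths : ∀ {n} (T : Tree n) {P : Set} → Dec P → ((∀ x y → ∃ (Dist (Tree.graph T) x y)) → ¬ ¬ P) → P
with-shortest-paths T P? ¬¬P = decidable-stable P? λ ¬P → shortest-paths T λ sp → ¬¬P sp ¬P

lemma12 : ∀ {n} (T : Tree n) → 3 ≤ n → (t : ℕ) → 2 ≤ t →
    let G = Tree.graph T in
    (∀ (u v : Fin n) (eu ev eut evt : ℕ) →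
      Ecc G u eu → Ecc G v ev →
      Ecc (Sierpinski G t) (replicate t u) eut →
      Ecc (Sierpinski G t) (replicate t v) evt →
      ev ≤ eu → evt ≤ eut)
    ×
    (∀ (u y z : Fin n) (eu eut ezt : ℕ) →
      EccentricVertex G u y → Adj G z y →
      Ecc G u eu →
      Ecc (Sierpinski G t) (replicate t u) eut →
      Ecc (Sierpinski G (t ∸ 1)) (replicate (t ∸ 1) z) ezt →
      eut + (2 ^ (t ∸ 1) ∸ 1) ≡ ezt + (2 ^ t ∸ 1) * eu)
lemma12 T 3≤n (suc t) _ =
  (λ u v eu ev eut evt Ecc-u Ecc-v Ecc-ut Ecc-vt ev≤eu → with-shortest-paths T (evt ≤? eut) λ sp →
     SierpinskiEcc.ecc-monotone T sp 3≤n (suc t) Ecc-u Ecc-v Ecc-ut Ecc-vt ev≤eu) ,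
  (λ u y z eu eut ezt uy zy Ecc-u Ecc-ut Ecc-zt → with-shortest-paths T (_ ≟ _) λ sp →
     SierpinskiEcc.ecc-recurrence T sp 3≤n t uy zy Ecc-u Ecc-ut Ecc-zt)
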